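{- Let $S$ be a set, $\sigma$ a binary relation on $S$, and $\mathcal{G}\subseteq\wp(S)$ a neighborhood granulation on $S$ with associated map $\gamma:S\to\mathcal{G}$. Let $\mathcal{I}_\sigma(S)$ be the set of $\sigma$-ideals, ordered by inclusion, and let $\mathcal{O}$ be a nontrivial antichain in $(\mathcal{I}_\sigma(S),\subseteq)$. Put $\mathcal{O}^+=\{B\in\mathcal{I}_\sigma(S): \exists C\in\mathcal{O},\ C\subseteq B\}$ and $\mathcal{O}^-=\mathcal{I}_\sigma(S)\setminus\mathcal{O}^+$. For $X\subseteq S$ (with $X^c=S\setminus X$) define $X^{l_*}=\{a\in X:\gamma(a)\cap X^c\in\mathcal{I}_\sigma(S)\}$, $X^{u_*}=\{a\in S:\gamma(a)\cap X\notin\mathcal{I}_\sigma(S)\}\cup X$, $X^{l_a}=\{a\in X:\gamma(a)\cap X^c\in\mathcal{O}^-\}$, $X^{u_a}=\{a\in S:\gamma(a)\cap X\notin\mathcal{O}^-\}\cup X$. Then for every $X\subseteq S$: $X^{l_a}\subseteq X^{l_*}\subseteq X$ and $X^{u_*}\subseteq X^{u_a}$.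
   Context: For $a,b\in S$, $U(a,b)=\{x\in S:\sigma ax\text{ and }\sigma bx\}$. A $\sigma$-ideal is a subset $K\subset S$ such that (i) for all $x\in S$ and $a\in K$, $\sigma xa$ implies $x\in K$, and (ii) for all $a,b\in K$, $U(a,b)\cap K\neq\emptyset$. An antichain is a set of pairwise incomparable elements. A neighborhood granulation on $S$ is a family $\mathcal{G}\subseteq\wp(S)$ with a map $\gamma:S\to\mathcal{G}$ that is surjective onto $\mathcal{G}$ and satisfies $\bigcup_{x\in S}\gamma(x)=S$. -}

module Defs where

open import Level using (0ℓ)
open import Data.Product using (Σ; ∃; _×_; _,_)
open import Data.Sum using (_⊎_)
open import Relation.Nullary using (¬_)
open import Relation.Unary using (Pred; _∈_; _⊆_; _∩_; ∁)
open import Relation.Binary using (Rel)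

Subset : Set → Set₁
Subset S = Pred S 0ℓ

_≐_ : {S : Set} → Subset S → Subset S → Set
A ≐ B = A ⊆ B × B ⊆ A

U : {S : Set} → Rel S 0ℓ → S → S → Subset S
U σ a b x = σ a x × σ b x

IsSigmaIdeal : {S : Set} → Rel S 0ℓ → Subset S → Set
IsSigmaIdeal {S} σ K =
  (∀ {x a} → a ∈ K → σ x a → x ∈ K) ×
  (∀ {a b} → a ∈ K → b ∈ K → ∃ λ x → x ∈ (U σ a b ∩ K))

IsNbhdGranulation : {S : Set} → Pred (Subset S) 0ℓ → (S → Subset S) → Set₁
IsNbhdGranulation {S} G γ =
  (∀ x → γ x ∈ G) ×
  (∀ B → B ∈ G → ∃ λ x → γ x ≐ B) ×
  (∀ y → ∃ λ x → y ∈ γ x)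

IsAntichain : {S : Set} → Rel S 0ℓ → Pred (Subset S) 0ℓ → Set₁
IsAntichain σ O =
  (∀ C → C ∈ O → IsSigmaIdeal σ C) ×
  (∀ C D → C ∈ O → D ∈ O → C ⊆ D → D ⊆ C)

IsNontrivial : {S : Set} → Pred (Subset S) 0ℓ → Set₁
IsNontrivial O = Σ _ λ C → Σ _ λ D → C ∈ O × D ∈ O × ¬ (C ≐ D)

OPlus : {S : Set} → Rel S 0ℓ → Pred (Subset S) 0ℓ → Subset S → Set₁
OPlus σ O B = IsSigmaIdeal σ B × (Σ _ λ C → C ∈ O × C ⊆ B)

OMinus : {S : Set} → Rel S 0ℓ → Pred (Subset S) 0ℓ → Subset S → Set₁
OMinus σ O B = IsSigmaIdeal σ B × ¬ (OPlus σ O B)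

lowerStar : {S : Set} → Rel S 0ℓ → (S → Subset S) → Subset S → Pred S _
lowerStar σ γ X a = X a × IsSigmaIdeal σ (γ a ∩ ∁ X)

upperStar : {S : Set} → Rel S 0ℓ → (S → Subset S) → Subset S → Pred S _
upperStar σ γ X a = (¬ IsSigmaIdeal σ (γ a ∩ X)) ⊎ X a

lowerA : {S : Set} → Rel S 0ℓ → (S → Subset S) → Pred (Subset S) 0ℓ → Subset S → Pred S _
lowerA σ γ O X a = X a × OMinus σ O (γ a ∩ ∁ X)

upperA : {S : Set} → Rel S 0ℓ → (S → Subset S) → Pred (Subset S) 0ℓ → Subset S → Pred S _
upperA σ γ O X a = (¬ OMinus σ O (γ a ∩ X)) ⊎ X a

-- Every member of O⁻ is a σ-ideal, so the O-approximations are squeezed between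
-- the σ-ideal approximations: l_a ⊆ l_* and u_* ⊆ u_a, and l_* ⊆ X by construction.
module Submission where

open import Defs
open import Level using (0ℓ)
open import Data.Product using (_×_; _,_; proj₁)
open import Data.Sum using (inj₁; inj₂)
open import Relation.Unary using (Pred; _⊆_)
open import Relation.Binary using (Rel)

module _ {S : Set} (σ : Rel S 0ℓ) (γ : S → Subset S) (O : Pred (Subset S) 0ℓ) where

  OMinus⇒IsSigmaIdeal : ∀ {B} → OMinus σ O B → IsSigmaIdeal σ B
  OMinus⇒IsSigmaIdeal = proj₁

  lowerA⊆lowerStar : (X : Subset S) → lowerA σ γ O X ⊆ lowerStar σ γ X
  lowerA⊆lowerStar X (a∈X , minus) = a∈X , OMinus⇒IsSigmaIdeal minus

  upperStar⊆upperA : (X : Subset S) → upperStar σ γ X ⊆ upperA σ γ O X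
  upperStar⊆upperA X (inj₁ ¬ideal) = inj₁ (λ minus → ¬ideal (OMinus⇒IsSigmaIdeal minus))
  upperStar⊆upperA X (inj₂ a∈X)    = inj₂ a∈X

lowerStar⊆ : {S : Set} (σ : Rel S 0ℓ) (γ : S → Subset S) (X : Subset S) → lowerStar σ γ X ⊆ X
lowerStar⊆ σ γ X = proj₁

mainTheorem7 : (S : Set) (σ : Rel S 0ℓ) (G : Pred (Subset S) 0ℓ) (γ : S → Subset S) →
    IsNbhdGranulation G γ →
    (O : Pred (Subset S) 0ℓ) → IsAntichain σ O → IsNontrivial O →
    (X : Subset S) →
    (lowerA σ γ O X ⊆ lowerStar σ γ X) × (lowerStar σ γ X ⊆ X) × (upperStar σ γ X ⊆ upperA σ γ O X)
mainTheorem7 S σ G γ _ O _ _ X =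
  lowerA⊆lowerStar σ γ O X , lowerStar⊆ σ γ X , upperStar⊆upperA σ γ O X
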